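{- Let $n\ge r\ge1$ be integers and $q$ a prime power. There exists a Kakeya set $K\subseteq\mathbb{F}_q^n$ of rank $r$ such that $$|K|\le\big(1-(1-q^{ -\lfloor n/q^r\rfloor})^{q^r}\big)q^n.$$
   Context: $\mathbb{F}_q$ denotes the finite field with $q$ elements. For a finite vector space $V$ and an integer $0\le r\le\dim V$, a subset $K\subseteq V$ is a Kakeya set of rank $r$ if for every subspace $L\le V$ with $\dim L=r$ there exists $v\in V$ such that $v+L\subseteq K$. -}

module Defs where

open import Level using (Level; _⊔_)
open import Data.Nat as ℕ using (ℕ; zero; suc; NonZero)
open import Data.Nat.Properties using (m^n≢0)
open import Data.Fin as F using (Fin)
open import Data.Product using (Σ; ∃; _×_; _,_)
open import Data.List using (List; length)
open import Data.List.Relation.Unary.Any using (Any)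
open import Relation.Binary.PropositionalEquality using (_≡_)
open import Relation.Nullary using (¬_)
open import Algebra.Bundles using (CommutativeRing)

record IsFieldCR {c ℓ : Level} (R : CommutativeRing c ℓ) : Set (c ⊔ ℓ) where
  open CommutativeRing R
  field
    0≉1 : ¬ (0# ≈ 1#)
    inverse : ∀ x → ¬ (x ≈ 0#) → Σ Carrier (λ y → (x * y) ≈ 1#)

record HasCard {c ℓ : Level} (R : CommutativeRing c ℓ) (q : ℕ) : Set (c ⊔ ℓ) where
  open CommutativeRing R
  field
    enum : Fin q → Carrier
    enum-injective : ∀ i j → enum i ≈ enum j → i ≡ j
    enum-surjective : ∀ x → Σ (Fin q) (λ i → enum i ≈ x)

module VectorSpace {c ℓ : Level} (F : CommutativeRing c ℓ) where
  open CommutativeRing F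

  Vec : ℕ → Set c
  Vec n = Fin n → Carrier

  _≋_ : ∀ {n} → Vec n → Vec n → Set ℓ
  u ≋ v = ∀ i → u i ≈ v i

  _⊕_ : ∀ {n} → Vec n → Vec n → Vec n
  (u ⊕ v) i = u i + v i

  _·_ : ∀ {n} → Carrier → Vec n → Vec n
  (a · v) i = a * v i

  zeroV : ∀ {n} → Vec n
  zeroV i = 0#

  lincomb : ∀ {n} r → (Fin r → Carrier) → (Fin r → Vec n) → Vec n
  lincomb zero    c b = zeroV
  lincomb (suc r) c b = (c F.zero · b F.zero) ⊕ lincomb r (λ j → c (F.suc j)) (λ j → b (F.suc j))

  LinIndep : ∀ {n} r → (Fin r → Vec n) → Set (c ⊔ ℓ)
  LinIndep r b = ∀ (cs : Fin r → Carrier) → lincomb r cs b ≋ zeroV → ∀ j → cs j ≈ 0#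

  InCoset : ∀ {n} r → Vec n → (Fin r → Vec n) → Vec n → Set (c ⊔ ℓ)
  InCoset r v b x = Σ (Fin r → Carrier) (λ cs → x ≋ (v ⊕ lincomb r cs b))

  _∈K_ : ∀ {n} → Vec n → List (Vec n) → Set (c ⊔ ℓ)
  x ∈K K = Any (λ y → x ≋ y) K

  IsKakeya : ∀ n r → List (Vec n) → Set (c ⊔ ℓ)
  IsKakeya n r K = ∀ (b : Fin r → Vec n) → LinIndep r b →
    Σ (Vec n) (λ v → ∀ x → InCoset r v b x → x ∈K K)

-- Cleared-denominator form of |K| ≤ (1 - (1 - q^{-m})^N) q^n with
-- N = q^r, m = ⌊n / N⌋:   |K| · q^{mN} ≤ (q^{mN} - (q^m - 1)^N) · q^n.
KakeyaBound : (q : ℕ) .{{_ : NonZero q}} → (n r k : ℕ) → Set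
KakeyaBound q n r k =
  let N = q ℕ.^ r
      m = ℕ._/_ n N {{m^n≢0 q r}}
  in k ℕ.* q ℕ.^ (m ℕ.* N) ℕ.≤ (q ℕ.^ (m ℕ.* N) ℕ.∸ (q ℕ.^ m ℕ.∸ 1) ℕ.^ N) ℕ.* q ℕ.^ n

{-# OPTIONS --safe #-}
-- Write n = s + m·N with N = q^r and m = ⌊n/N⌋, and split the coordinates of
-- F^n into s free ones and N blocks of m coordinates, the blocks indexed by
-- the coefficient vectors t ∈ F^r. Let K be the set of vectors having at least
-- one zero block. Given L = span(b₁,…,b_r), choose v so that on block t it
-- equals −Σ tⱼbⱼ; the point v + Σ cⱼbⱼ of v + L then vanishes on block c, so
-- v + L ⊆ K. Finally |K| = (q^{mN} − (q^m − 1)^N)·q^s, which is the bound.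
module Submission where

open import Defs
open import Level using (Level)
open import Data.Nat using (ℕ; NonZero; _≤_; zero; suc; _+_; _*_; _^_; _∸_; _/_; _%_)
open import Data.Product using (Σ; _×_; ∃; _,_; proj₁; proj₂)
open import Data.List using (List; length; []; _∷_; [_]; _++_; map; tabulate; cartesianProductWith)
open import Algebra.Bundles using (CommutativeRing)

open import Data.Nat.Properties
  using (+-assoc; +-comm; *-assoc; *-distribˡ-+; *-distribʳ-+; ^-zeroˡ; ^-*-assoc;
         ^-distribˡ-+-*; m+n∸n≡m; m+[n∸m]≡n; m^n>0; m^n≢0; ≤-reflexive)
open import Data.Nat.DivMod using (m≡m%n+[m/n]*n)
open import Data.Fin using (Fin; zero; suc; punchIn; punchOut; cast; finToFun; funToFin)
open import Data.Fin.Properties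
  using (_≟_; punchIn-punchOut; cast-involutive; +↔⊎; *↔×; finToFun-funToFin; ¬∀⟶∃¬; all?)
open import Data.Vec.Functional as V using (Vector)
open import Data.Sum using (_⊎_; inj₁; inj₂; [_,_]′)
open import Data.Sum.Function.Propositional using (_⊎-↔_)
open import Data.List.Properties using (length-++; length-map; length-tabulate)
open import Data.List.Relation.Unary.Any using (Any; here)
open import Data.List.Relation.Unary.Any.Properties using (++⁺ˡ; ++⁺ʳ; tabulate⁺; cartesianProductWith⁺)
open import Function using (_∘_)
open import Function.Bundles using (Inverse; _↔_; mk↔ₛ′)
open import Function.Properties.Inverse using (↔-refl; ↔-trans)
open import Relation.Binary.PropositionalEquality using (_≡_; refl; sym; trans; cong; cong₂; subst; module ≡-Reasoning)
open import Relation.Nullary using (¬_; Dec; yes; no; ¬?; contradiction)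
open import Relation.Nullary.Decidable using (decidable-stable)
open import Relation.Unary using (Decidable)
import Relation.Binary.Reasoning.Setoid as SetoidReasoning

module _ {a b c : Level} {A : Set a} {B : Set b} {C : Set c} where

  length-cartesianProductWith : ∀ (f : A → B → C) xs ys →
    length (cartesianProductWith f xs ys) ≡ length xs * length ys
  length-cartesianProductWith f []       ys = refl
  length-cartesianProductWith f (x ∷ xs) ys = begin
    length (map (f x) ys ++ cartesianProductWith f xs ys)
      ≡⟨ length-++ (map (f x) ys) ⟩
    length (map (f x) ys) + length (cartesianProductWith f xs ys)
      ≡⟨ cong₂ _+_ (length-map (f x) ys) (length-cartesianProductWith f xs ys) ⟩
    length ys + length xs * length ys ∎
    where open ≡-Reasoning

module _ {a : Level} {X : Set a} where

  tuples : List X → ∀ k → List (Vector X k)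
  tuples xs zero    = [ V.[] ]
  tuples xs (suc k) = cartesianProductWith V._∷_ xs (tuples xs k)

  -- Tuples with entries in good ++ bad, at least one of them in good.
  tuplesMeeting : (good bad : List X) → ∀ k → List (Vector X k)
  tuplesMeeting good bad zero    = []
  tuplesMeeting good bad (suc k) =
    cartesianProductWith V._∷_ good (tuples (good ++ bad) k) ++
    cartesianProductWith V._∷_ bad (tuplesMeeting good bad k)

  length-tuples : ∀ xs k → length (tuples xs k) ≡ length xs ^ k
  length-tuples xs zero    = refl
  length-tuples xs (suc k) =
    trans (length-cartesianProductWith V._∷_ xs (tuples xs k))
          (cong (length xs *_) (length-tuples xs k))

  length-tuplesMeeting : ∀ good bad k →
    length (tuplesMeeting good bad k) + length bad ^ k ≡ (length good + length bad) ^ k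
  length-tuplesMeeting good bad zero    = refl
  length-tuplesMeeting good bad (suc k) = begin
    length (P ++ Q) + b * b ^ k                  ≡⟨ cong (_+ b * b ^ k) (length-++ P) ⟩
    length P + length Q + b * b ^ k
      ≡⟨ cong₂ (λ u v → u + v + b * b ^ k)
           (length-cartesianProductWith V._∷_ good (tuples (good ++ bad) k))
           (length-cartesianProductWith V._∷_ bad (tuplesMeeting good bad k)) ⟩
    g * length (tuples (good ++ bad) k) + b * L + b * b ^ k
      ≡⟨ +-assoc (g * length (tuples (good ++ bad) k)) (b * L) (b * b ^ k) ⟩
    g * length (tuples (good ++ bad) k) + (b * L + b * b ^ k)
      ≡⟨ cong₂ _+_ (cong (g *_) length-all) (sym (*-distribˡ-+ b L (b ^ k))) ⟩
    g * T + b * (L + b ^ k)                      ≡⟨ cong (λ u → g * T + b * u) (length-tuplesMeeting good bad k) ⟩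
    g * T + b * T                                ≡⟨ sym (*-distribʳ-+ T g b) ⟩
    (g + b) * T                                  ∎
    where
    open ≡-Reasoning
    P = cartesianProductWith V._∷_ good (tuples (good ++ bad) k)
    Q = cartesianProductWith V._∷_ bad (tuplesMeeting good bad k)
    g = length good
    b = length bad
    L = length (tuplesMeeting good bad k)
    T = (g + b) ^ k
    length-all : length (tuples (good ++ bad) k) ≡ T
    length-all = trans (length-tuples (good ++ bad) k) (cong (_^ k) (length-++ good))

module _ {a ℓ : Level} {X : Set a} (_∼_ : X → X → Set ℓ) where

  Pointwise : ∀ {k} → Vector X k → Vector X k → Set ℓ
  Pointwise w v = ∀ i → w i ∼ v i

  ∷-pointwise : ∀ {k} (w : Vector X (suc k)) {x v} →
    w zero ∼ x → Pointwise (V.tail w) v → Pointwise w (x V.∷ v)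
  ∷-pointwise w w₀∼x _  zero    = w₀∼x
  ∷-pointwise w _    ws (suc i) = ws i

  tuples-complete : ∀ xs k (w : Vector X k) →
    (∀ i → Any (w i ∼_) xs) → Any (Pointwise w) (tuples xs k)
  tuples-complete xs zero    w _   = here (λ ())
  tuples-complete xs (suc k) w cov =
    cartesianProductWith⁺ V._∷_ (∷-pointwise w)
      (cov zero) (tuples-complete xs k (V.tail w) (cov ∘ suc))

  module _ {p : Level} {P : X → Set p} (P? : Decidable P) {good bad : List X}
           (good-complete : ∀ x → P x → Any (x ∼_) good)
           (bad-complete : ∀ x → ¬ P x → Any (x ∼_) bad) where

    ++-complete : ∀ x → Any (x ∼_) (good ++ bad)
    ++-complete x with P? x
    ... | yes px  = ++⁺ˡ (good-complete x px)
    ... | no ¬px  = ++⁺ʳ good (bad-complete x ¬px)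

    tuplesMeeting-complete : ∀ k (w : Vector X k) →
      (∃ λ i → P (w i)) → Any (Pointwise w) (tuplesMeeting good bad k)
    tuplesMeeting-complete (suc k) w (i , pwᵢ) with P? (w zero)
    ... | yes pw₀ = ++⁺ˡ (cartesianProductWith⁺ V._∷_ (∷-pointwise w) (good-complete _ pw₀)
                    (tuples-complete (good ++ bad) k (V.tail w) (++-complete ∘ V.tail w)))
    tuplesMeeting-complete (suc k) w (zero  , pw₀) | no ¬pw₀ = contradiction pw₀ ¬pw₀
    tuplesMeeting-complete (suc k) w (suc i , pwᵢ) | no ¬pw₀ =
      ++⁺ʳ _ (cartesianProductWith⁺ V._∷_ (∷-pointwise w) (bad-complete _ ¬pw₀)
                (tuplesMeeting-complete k (V.tail w) (i , pwᵢ)))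

module FiniteRing {c ℓ : Level} (R : CommutativeRing c ℓ) (k : ℕ) (card : HasCard R (suc k)) where
  open CommutativeRing R
    using (Carrier; _≈_; 0#; -_; setoid; +-cong; *-cong; -‿cong; -‿inverseˡ)
    renaming (refl to ≈-refl; sym to ≈-sym; trans to ≈-trans; _+_ to _+ᴿ_)
  open HasCard card
  open VectorSpace R

  q : ℕ
  q = suc k

  zeroIndex : Fin q
  zeroIndex = proj₁ (enum-surjective 0#)

  enum-zeroIndex : enum zeroIndex ≈ 0#
  enum-zeroIndex = proj₂ (enum-surjective 0#)

  _≈0? : ∀ x → Dec (x ≈ 0#)
  x ≈0? with enum-surjective x
  ... | i , eᵢ with i ≟ zeroIndex
  ... | yes refl = yes (≈-trans (≈-sym eᵢ) enum-zeroIndex)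
  ... | no i≢i₀  = no (λ x≈0 → i≢i₀ (enum-injective i zeroIndex
                      (≈-trans eᵢ (≈-trans x≈0 (≈-sym enum-zeroIndex)))))

  nonzeros : List Carrier
  nonzeros = tabulate (enum ∘ punchIn zeroIndex)

  nonzeros-complete : ∀ x → ¬ (x ≈ 0#) → Any (x ≈_) nonzeros
  nonzeros-complete x x≉0 with enum-surjective x
  ... | i , eᵢ with zeroIndex ≟ i
  ... | yes refl = contradiction (≈-trans (≈-sym eᵢ) enum-zeroIndex) x≉0
  ... | no i₀≢i  = tabulate⁺ (punchOut i₀≢i)
                     (subst (λ j → x ≈ enum j) (sym (punchIn-punchOut i₀≢i)) (≈-sym eᵢ))

  zero-complete : ∀ x → ¬ ¬ (x ≈ 0#) → Any (x ≈_) [ 0# ]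
  zero-complete x ¬x≉0 = here (decidable-stable (x ≈0?) ¬x≉0)

  vectors : ∀ n → List (Vec n)
  vectors = tuples (nonzeros ++ [ 0# ])

  nonzeroVectors : ∀ n → List (Vec n)
  nonzeroVectors = tuplesMeeting nonzeros [ 0# ]

  vectors-complete : ∀ n (w : Vec n) → Any (w ≋_) (vectors n)
  vectors-complete n w =
    tuples-complete _≈_ _ n w (λ i → ++-complete _≈_ (¬? ∘ _≈0?) nonzeros-complete zero-complete (w i))

  nonzeroVectors-complete : ∀ n (w : Vec n) → ¬ (w ≋ zeroV) → Any (w ≋_) (nonzeroVectors n)
  nonzeroVectors-complete n w w≉0 =
    tuplesMeeting-complete _≈_ (¬? ∘ _≈0?) nonzeros-complete zero-complete n w
      (¬∀⟶∃¬ n _ (λ i → w i ≈0?) w≉0)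

  length-scalars : length nonzeros + length [ 0# ] ≡ q
  length-scalars = trans (cong (_+ 1) (length-tabulate (enum ∘ punchIn zeroIndex))) (+-comm k 1)

  length-vectors : ∀ n → length (vectors n) ≡ q ^ n
  length-vectors n = trans (length-tuples (nonzeros ++ [ 0# ]) n)
                           (cong (_^ n) (trans (length-++ nonzeros) length-scalars))

  length-nonzeroVectors : ∀ n → length (nonzeroVectors n) ≡ q ^ n ∸ 1
  length-nonzeroVectors n = begin
    length (nonzeroVectors n)           ≡⟨ sym (m+n∸n≡m _ 1) ⟩
    length (nonzeroVectors n) + 1 ∸ 1   ≡⟨ cong (λ u → length (nonzeroVectors n) + u ∸ 1) (sym (^-zeroˡ n)) ⟩
    length (nonzeroVectors n) + 1 ^ n ∸ 1
      ≡⟨ cong (_∸ 1) (trans (length-tuplesMeeting nonzeros [ 0# ] n) (cong (_^ n) length-scalars)) ⟩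
    q ^ n ∸ 1                           ∎
    where open ≡-Reasoning

  blockTuples : ∀ m N → List (Vector (Vec m) N)
  blockTuples m = tuplesMeeting [ zeroV ] (nonzeroVectors m)

  blockTuples-complete : ∀ m N (B : Vector (Vec m) N) →
    (∃ λ t → B t ≋ zeroV) → Any (Pointwise _≋_ B) (blockTuples m N)
  blockTuples-complete m =
    tuplesMeeting-complete _≋_ (λ w → all? (λ i → w i ≈0?)) (λ w w≈0 → here w≈0) (nonzeroVectors-complete m)

  length-blockTuples : ∀ m N → length (blockTuples m N) ≡ q ^ (m * N) ∸ (q ^ m ∸ 1) ^ N
  length-blockTuples m N = begin
    length (blockTuples m N)                              ≡⟨ sym (m+n∸n≡m _ ((q ^ m ∸ 1) ^ N)) ⟩
    length (blockTuples m N) + (q ^ m ∸ 1) ^ N ∸ (q ^ m ∸ 1) ^ N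
      ≡⟨ cong (λ u → length (blockTuples m N) + u ^ N ∸ (q ^ m ∸ 1) ^ N) (sym (length-nonzeroVectors m)) ⟩
    length (blockTuples m N) + length (nonzeroVectors m) ^ N ∸ (q ^ m ∸ 1) ^ N
      ≡⟨ cong (_∸ (q ^ m ∸ 1) ^ N) (length-tuplesMeeting [ zeroV ] (nonzeroVectors m) N) ⟩
    (1 + length (nonzeroVectors m)) ^ N ∸ (q ^ m ∸ 1) ^ N
      ≡⟨ cong (λ u → (1 + u) ^ N ∸ (q ^ m ∸ 1) ^ N) (length-nonzeroVectors m) ⟩
    (1 + (q ^ m ∸ 1)) ^ N ∸ (q ^ m ∸ 1) ^ N
      ≡⟨ cong (λ u → u ^ N ∸ (q ^ m ∸ 1) ^ N) (m+[n∸m]≡n (m^n>0 q m)) ⟩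
    (q ^ m) ^ N ∸ (q ^ m ∸ 1) ^ N                         ≡⟨ cong (_∸ (q ^ m ∸ 1) ^ N) (^-*-assoc q m N) ⟩
    q ^ (m * N) ∸ (q ^ m ∸ 1) ^ N                         ∎
    where open ≡-Reasoning

  lincomb-cong : ∀ {n} r {cs cs′ : Vec r} (b : Fin r → Vec n) → cs ≋ cs′ → lincomb r cs b ≋ lincomb r cs′ b
  lincomb-cong zero    b cs≋cs′ i = ≈-refl
  lincomb-cong (suc r) b cs≋cs′ i =
    +-cong (*-cong (cs≋cs′ zero) ≈-refl) (lincomb-cong r (b ∘ suc) (cs≋cs′ ∘ suc) i)

  coeffs : ∀ r → Fin (q ^ r) → Vec r
  coeffs r t = enum ∘ finToFun t

  coeffs-surjective : ∀ r (cs : Vec r) → ∃ λ t → coeffs r t ≋ cs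
  coeffs-surjective r cs = funToFin indices , λ j →
    subst (λ i → enum i ≈ cs j) (sym (finToFun-funToFin indices j)) (proj₂ (enum-surjective (cs j)))
    where
    indices : Fin r → Fin q
    indices = proj₁ ∘ enum-surjective ∘ cs

  module Construction (n r : ℕ) where
    N : ℕ
    N = q ^ r

    instance
      N≢0 : NonZero N
      N≢0 = m^n≢0 q r

    m s : ℕ
    m = n / N
    s = n % N

    Coordinate : Set
    Coordinate = Fin s ⊎ (Fin m × Fin N)

    -- A coordinate inj₂ (p , t) is position p of the block indexed by coeffs r t.
    coordinates : Fin n ↔ Coordinate
    coordinates = ↔-trans castᵢ (↔-trans +↔⊎ (↔-refl ⊎-↔ *↔×))
      where
      n≡s+m*N : n ≡ s + m * N
      n≡s+m*N = m≡m%n+[m/n]*n n N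
      castᵢ : Fin n ↔ Fin (s + m * N)
      castᵢ = mk↔ₛ′ (cast n≡s+m*N) (cast (sym n≡s+m*N))
                (cast-involutive n≡s+m*N (sym n≡s+m*N)) (cast-involutive (sym n≡s+m*N) n≡s+m*N)

    open Inverse coordinates using (to; from; strictlyInverseˡ; strictlyInverseʳ)

    glue : Vector (Vec m) N → Vec s → Coordinate → Carrier
    glue B T = [ T , (λ (p , t) → B t p) ]′

    assemble : Vector (Vec m) N → Vec s → Vec n
    assemble B T = glue B T ∘ to

    assemble-complete : ∀ (x : Vec n) {B T} →
      Pointwise _≋_ (λ t p → x (from (inj₂ (p , t)))) B → (x ∘ from ∘ inj₁) ≋ T →
      x ≋ assemble B T
    assemble-complete x {B} {T} blocks≋B free≋T i =
      subst (λ j → x j ≈ assemble B T i) (strictlyInverseʳ i) (glued (to i))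
      where
      glued : ∀ w → x (from w) ≈ glue B T w
      glued (inj₁ u)       = free≋T u
      glued (inj₂ (p , t)) = blocks≋B t p

    kakeyaSet : List (Vec n)
    kakeyaSet = cartesianProductWith assemble (blockTuples m N) (vectors s)

    kakeyaSet-isKakeya : IsKakeya n r kakeyaSet
    kakeyaSet-isKakeya b _ = v , covered
      where
      offset : Fin n → Coordinate → Carrier
      offset i = [ (λ _ → 0#) , (λ (_ , t) → - lincomb r (coeffs r t) b i) ]′

      v : Vec n
      v i = offset i (to i)

      block-vanishes : ∀ {x} cs → x ≋ (v ⊕ lincomb r cs b) → ∀ t → coeffs r t ≋ cs →
        (λ p → x (from (inj₂ (p , t)))) ≋ zeroV
      block-vanishes {x} cs x≋ t t≋cs p = begin
        x i                                                  ≈⟨ x≋ i ⟩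
        v i +ᴿ lincomb r cs b i                              ≡⟨ cong (λ w → offset i w +ᴿ lincomb r cs b i) (strictlyInverseˡ (inj₂ (p , t))) ⟩
        - lincomb r (coeffs r t) b i +ᴿ lincomb r cs b i     ≈⟨ +-cong (-‿cong (lincomb-cong r b t≋cs i)) ≈-refl ⟩
        - lincomb r cs b i +ᴿ lincomb r cs b i               ≈⟨ -‿inverseˡ _ ⟩
        0#                                                   ∎
        where
        open SetoidReasoning setoid
        i = from (inj₂ (p , t))

      covered : ∀ x → InCoset r v b x → x ∈K kakeyaSet
      covered x (cs , x≋) with coeffs-surjective r cs
      ... | t , t≋cs =
        cartesianProductWith⁺ assemble (assemble-complete x)
          (blockTuples-complete m N _ (t , block-vanishes cs x≋ t t≋cs))
          (vectors-complete s _)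

    kakeyaSet-bound : KakeyaBound q n r (length kakeyaSet)
    kakeyaSet-bound = ≤-reflexive (begin
      length kakeyaSet * q ^ (m * N)          ≡⟨ cong (_* q ^ (m * N)) (length-cartesianProductWith assemble (blockTuples m N) (vectors s)) ⟩
      length (blockTuples m N) * length (vectors s) * q ^ (m * N)
        ≡⟨ cong₂ (λ u w → u * w * q ^ (m * N)) (length-blockTuples m N) (length-vectors s) ⟩
      D * q ^ s * q ^ (m * N)                 ≡⟨ *-assoc D (q ^ s) (q ^ (m * N)) ⟩
      D * (q ^ s * q ^ (m * N))               ≡⟨ cong (D *_) (sym (^-distribˡ-+-* q s (m * N))) ⟩
      D * q ^ (s + m * N)                     ≡⟨ cong (λ u → D * q ^ u) (sym (m≡m%n+[m/n]*n n N)) ⟩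
      D * q ^ n                               ∎)
      where
      open ≡-Reasoning
      D = q ^ (m * N) ∸ (q ^ m ∸ 1) ^ N

theorem6 : ∀ {c ℓ : Level} (q : ℕ) .{{_ : NonZero q}} (F : CommutativeRing c ℓ) →
    IsFieldCR F → HasCard F q →
    (n r : ℕ) → 1 ≤ r → r ≤ n →
    Σ (List (VectorSpace.Vec F n)) (λ K →
      VectorSpace.IsKakeya F n r K × KakeyaBound q n r (length K))
theorem6 zero    F _ card n r _ _ with HasCard.enum-surjective card (CommutativeRing.0# F)
... | () , _
theorem6 (suc k) F _ card n r _ _ = kakeyaSet , kakeyaSet-isKakeya , kakeyaSet-bound
  where open FiniteRing.Construction F k card n r
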